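{- Let $S$ be a set of clauses, $M_{g(S)}$ a model of $g(S)$, $F(S)=Filter(Gr(ng(S)),M_{g(S)})$, and let $P_C$, $M_{<C}$ and $M^{F(S)}$ be as defined in the context. Let $C$ be a clause in $F(S)$ and $L$ a literal in $C$. Then (1) if $L$ is not maximum in $C$, then $M^{F(S)}\models L$ if and only if $M_{<C}\models L$; (2) if $C$ produces $L$, then $L\in M^{F(S)}$.
   Context: First-order logic without equality. A literal is an atom or its negation; $\bar L$ is the complement of $L$. A clause is a finite multiset of literals read as a disjunction; $L\vee\Gamma$ denotes $\{L\}\cup\Gamma$. For a set of clauses $S$, $g(S)$ (resp. $ng(S)$) is the set of ground (resp. non-ground) clauses of $S$; $Gr(C)=\{C\theta: C\theta\text{ ground}\}$, $Gr(S)=\bigcup_{C\in S}Gr(C)$. A fixed ordering $<$ on atoms is well-founded, stable under substitution, totalizable on ground atoms; it is extended to literals with $A<\neg A$ for each atom $A$ and so that $L>M$ implies $L>\bar M$; clauses are compared by the multiset extension; on ground literals and clauses a total extension is used ("largest", "maximum" refer to it; $L$ is maximum in $C$ if larger than all other literals of $C$). A (partial) interpretation is a consistent set $I$ of ground literals; $I\models L$ iff $L\in I$; for ground $C$, $I\models C$ iff $I\cap C\neq\emptyset$; for non-ground $C$, $I\models C$ iff $I\models Gr(C)$. $Filter(C,I)=\{L\in C: I\not\models\bar L\}$ and $Filter(S,I)=\{Filter(C,I): C\in S, I\not\models C\}$. A selection function $Sel$ maps each clause $C$ to $Sel(C)\subseteq C$ (its selected literals). For $C\in ng(S)$, a ground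 substitution $\theta$ and $C'=Filter(C\theta,M_{g(S)})$, a literal $L\theta$ of $C'$ counts as selected in $C'$ iff $L$ is selected in $C$. For a set $T$ of positive ground literals and a set $U$ of ground literals, $Int(T,U)=T\cup\{\neg A: A\notin T,\ (U-T)\cap\{A,\neg A\}\neq\emptyset\}$. By well-founded recursion, for each $C\in F(S)$: $P_{<C}=\bigcup_{D\in F(S),D<C}P_D$; $M_{<C}=Int(P_{<C},\ C\cup\bigcup\{D\in F(S): D<C\})$ (union of the literals of these clauses); $P_C=\{A\}$ if $M_{<C}\not\models C$, the atom $A$ is the largest literal of $C$, $A$ is selected in $C$, and $A$ occurs only once in $C$ — in which case $C$ is said to produce $A$; otherwise $P_C=\emptyset$. Finally $P^{F(S)}=\bigcup_{C\in F(S)}P_C$ and $M^{F(S)}=Int(P^{F(S)},\bigcup F(S))$ (where $\bigcup F(S)$ is the set of all literals occurring in clauses of $F(S)$). -}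

module Defs where

open import Data.Nat using (ℕ)
open import Data.Vec using (Vec; []; _∷_)
open import Data.List using (List; []; _∷_; _++_)
open import Data.List.Membership.Propositional using (_∈_)
open import Data.List.Relation.Unary.All using (All)
open import Data.List.Relation.Unary.Any using (Any)
open import Data.List.Relation.Binary.Permutation.Propositional using (_↭_)
open import Data.Product using (Σ; ∃; ∃-syntax; _×_; _,_; proj₁)
open import Data.Sum using (_⊎_)
open import Data.Unit using (⊤)
open import Data.Empty using (⊥)
open import Relation.Nullary using (¬_)
open import Relation.Binary.PropositionalEquality using (_≡_; _≢_)
open import Induction.WellFounded using (WellFounded)
open import Level using (0ℓ)
open import Function.Bundles using (_⇔_)

record Signature : Set₁ where
  field
    Fun    : Set
    arity  : Fun → ℕ
    Pred   : Set
    parity : Pred → ℕ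

module Syntax (sig : Signature) where
  open Signature sig

  data Term : Set where
    var : ℕ → Term
    fun : (f : Fun) → Vec Term (arity f) → Term

  data Atom : Set where
    atom : (p : Pred) → Vec Term (parity p) → Atom

  data Literal : Set where
    pos : Atom → Literal
    neg : Atom → Literal

  -- clauses: finite multisets of literals, represented by lists
  -- (multiset equality is _↭_)
  Clause : Set
  Clause = List Literal

  Subst : Set
  Subst = ℕ → Term

  mutual
    subT : Subst → Term → Term
    subT θ (var x)    = θ x
    subT θ (fun f ts) = fun f (subTs θ ts)

    subTs : ∀ {n} → Subst → Vec Term n → Vec Term n
    subTs θ []       = []
    subTs θ (t ∷ ts) = subT θ t ∷ subTs θ ts

  subA : Subst → Atom → Atom
  subA θ (atom p ts) = atom p (subTs θ ts)

  subL : Subst → Literal → Literal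
  subL θ (pos A) = pos (subA θ A)
  subL θ (neg A) = neg (subA θ A)

  subC : Subst → Clause → Clause
  subC θ []      = []
  subC θ (L ∷ C) = subL θ L ∷ subC θ C

  mutual
    groundT : Term → Set
    groundT (var x)    = ⊥
    groundT (fun f ts) = groundTs ts

    groundTs : ∀ {n} → Vec Term n → Set
    groundTs []       = ⊤
    groundTs (t ∷ ts) = groundT t × groundTs ts

  groundA : Atom → Set
  groundA (atom p ts) = groundTs ts

  groundL : Literal → Set
  groundL (pos A) = groundA A
  groundL (neg A) = groundA A

  groundC : Clause → Set
  groundC C = All groundL C

  atomOf : Literal → Atom
  atomOf (pos A) = A
  atomOf (neg A) = A

  compl : Literal → Literal
  compl (pos A) = neg A
  compl (neg A) = pos A

  -- The orderings.  _<ₐ_ : the given ordering on atoms; _<ₗ_ : its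
  -- extension to literals; _≺_ : the total extension used on ground
  -- literals ("largest", "maximum" refer to _≺_).
  record Ordering : Set₁ where
    field
      _<ₐ_      : Atom → Atom → Set
      <ₐ-wf     : WellFounded _<ₐ_
      <ₐ-stable : ∀ (θ : Subst) A B → A <ₐ B → subA θ A <ₐ subA θ B
      _<ₗ_      : Literal → Literal → Set
      <ₗ-ext    : ∀ A B → A <ₐ B → pos A <ₗ pos B
      <ₗ-posneg : ∀ A → pos A <ₗ neg A
      <ₗ-compl  : ∀ L M → atomOf L ≢ atomOf M → M <ₗ L → compl M <ₗ L
      _≺_       : Literal → Literal → Set
      ≺-ext     : ∀ L M → groundL L → groundL M → L <ₗ M → L ≺ M
      ≺-irrefl  : ∀ L → groundL L → ¬ (L ≺ L)
      ≺-trans   : ∀ L M N → groundL L → groundL M → groundL N →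
                  L ≺ M → M ≺ N → L ≺ N
      ≺-total   : ∀ L M → groundL L → groundL M → L ≺ M ⊎ L ≡ M ⊎ M ≺ L
      ≺-wf      : WellFounded {A = Σ Literal groundL}
                    (λ x y → proj₁ x ≺ proj₁ y)

  module Construction (ord : Ordering) (S : Clause → Set)
                      (Sel : Clause → Literal → Set)
                      (Mg : Literal → Set) where
    open Ordering ord

    IsInterpretation : (Literal → Set) → Set
    IsInterpretation I = (∀ L → I L → groundL L) × (∀ A → ¬ (I (pos A) × I (neg A)))

    -- I ⊨ C for ground C
    _⊨_ : (Literal → Set) → Clause → Set
    I ⊨ C = ∃[ L ] (L ∈ C × I L)

    _⊨Gr_ : (Literal → Set) → Clause → Set
    I ⊨Gr C = ∀ (θ : Subst) → groundC (subC θ C) → I ⊨ subC θ C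

    IsSelection : Set
    IsSelection = ∀ C L → Sel C L → L ∈ C

    g : Clause → Set
    g C = S C × groundC C

    ng : Clause → Set
    ng C = S C × ¬ groundC C

    -- Filter(C, I) as a relation:  FilterRel I C C'  iff  C' = Filter(C,I)
    data FilterRel (I : Literal → Set) : Clause → Clause → Set where
      f-nil  : FilterRel I [] []
      f-keep : ∀ {L C C'} → ¬ I (compl L) → FilterRel I C C' → FilterRel I (L ∷ C) (L ∷ C')
      f-drop : ∀ {L C C'} → I (compl L) → FilterRel I C C' → FilterRel I (L ∷ C) C'

    -- C' arises in F(S) = Filter(Gr(ng(S)), Mg) from C ∈ ng(S) and θ
    Origin : Clause → Clause → Subst → Set
    Origin C' C θ = ng C × groundC (subC θ C) × ¬ (Mg ⊨ subC θ C)
                    × ∃[ C'' ] (FilterRel Mg (subC θ C) C'' × C' ↭ C'')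

    F : Clause → Set
    F C' = ∃[ C ] ∃[ θ ] Origin C' C θ

    -- selected literals of clauses of F(S), inherited from ng(S)
    Selected : Literal → Clause → Set
    Selected K C' = K ∈ C' × ∃[ C ] ∃[ θ ] (Origin C' C θ × ∃[ L ] (Sel C L × subL θ L ≡ K))

    -- multiset extension of _≺_ (ordering on (ground) clauses)
    _<c_ : Clause → Clause → Set
    D <c C = ∃[ X ] ∃[ Y ] ∃[ Z ] (C ↭ X ++ Z × D ↭ Y ++ Z × X ≢ []
                                   × All (λ y → Any (λ x → y ≺ x) X) Y)

    Largest : Literal → Clause → Set
    Largest L C = L ∈ C × All (λ K → K ≺ L ⊎ K ≡ L) C

    IsMaximum : Literal → Clause → Set
    IsMaximum L C = ∃[ C' ] (C ↭ L ∷ C' × All (λ K → K ≺ L) C')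

    OccursOnce : Literal → Clause → Set
    OccursOnce L C = ∃[ C' ] (C ↭ L ∷ C' × ¬ (L ∈ C'))

    Int : (Atom → Set) → (Literal → Set) → (Literal → Set)
    Int T U K = (∃[ A ] (K ≡ pos A × T A))
              ⊎ (∃[ A ] (K ≡ neg A × ¬ T A
                   × ∃[ K' ] (U K' × ¬ (∃[ B ] (K' ≡ pos B × T B))
                              × (K' ≡ pos A ⊎ K' ≡ neg A))))

    -- Given a candidate family Prod (Prod C A  means  P_C = {A}):
    module WithProd (Prod : Clause → Atom → Set) where
      P<_ : Clause → Atom → Set
      (P< C) A = ∃[ D ] (F D × D <c C × Prod D A)

      M<_ : Clause → Literal → Set
      M< C = Int (P< C) (λ K → K ∈ C ⊎ ∃[ D ] (F D × D <c C × K ∈ D))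

      PF : Atom → Set
      PF A = ∃[ C ] (F C × Prod C A)

      MF : Literal → Set
      MF = Int PF (λ K → ∃[ C ] (F C × K ∈ C))

      -- Prod satisfies the well-founded recursive definition of P_C
      IsProduction : Set
      IsProduction = ∀ C A → F C →
        (Prod C A ⇔ (¬ ((M< C) ⊨ C) × Largest (pos A) C
                     × Selected (pos A) C × OccursOnce (pos A) C))

-- A clause D that produces B has pos B as its maximum literal.  Hence if neg B
-- occurs in C (pos B ≺ neg B), or pos B occurs in C but is not maximum there
-- (C has another literal ≽ pos B), then D <c C.  So every producer of B lies
-- below C, so B ∈ P^{F(S)} iff B ∈ P_{<C}; as L itself occurs among the literals
-- that both Int constructions range over, M^{F(S)} and M_{<C} agree on L.
-- Neither part uses Sel or the fact that Mg is a model of g(S).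
module Submission where

open import Defs
open import Data.List using ([]; _∷_; _++_)
open import Data.List.Membership.Propositional using (_∈_; lose)
open import Data.List.Membership.Propositional.Properties using (∈-∃++)
open import Data.List.Relation.Unary.All as All using (All; []; _∷_)
open import Data.List.Relation.Unary.Any as Any using (Any; here; there)
open import Data.List.Relation.Binary.Permutation.Propositional
  using (_↭_; ↭-sym; ↭-trans)
open import Data.List.Relation.Binary.Permutation.Propositional.Properties
  using (All-resp-↭; ∷↭∷ʳ; ++-identityʳ; shift)
open import Data.Product using (∃-syntax; _×_; _,_; proj₂)
open import Data.Sum using (_⊎_; inj₁; inj₂)
open import Data.Empty using (⊥-elim)
open import Level using (0ℓ)
open import Relation.Nullary using (¬_; contraposition)
open import Relation.Binary.PropositionalEquality using (_≡_; _≢_; refl; sym)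
open import Function.Bundles using (_⇔_; mk⇔; Equivalence)
open import Function.Properties.Equivalence as ⇔ using (⇔-setoid)
open import Relation.Binary.Reasoning.Setoid (⇔-setoid 0ℓ)

¬-cong-⇔ : ∀ {A B : Set} → A ⇔ B → (¬ A) ⇔ (¬ B)
¬-cong-⇔ A⇔B =
  mk⇔ (contraposition (Equivalence.from A⇔B)) (contraposition (Equivalence.to A⇔B))

Any⇒≢[] : ∀ {A : Set} {P : A → Set} {xs} → Any P xs → xs ≢ []
Any⇒≢[] (here _)  ()
Any⇒≢[] (there _) ()

∈⇒↭∷ : ∀ {A : Set} {x : A} {xs} → x ∈ xs → ∃[ ys ] (xs ↭ x ∷ ys)
∈⇒↭∷ x∈xs with ys , zs , refl ← ∈-∃++ x∈xs = ys ++ zs , shift _ ys zs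

module _ (sig : Signature) where
  open Syntax sig

  module _ (ord : Ordering) where
    open Ordering ord

    _≼_ : Literal → Literal → Set
    K ≼ L = K ≺ L ⊎ K ≡ L

    ≼-≺-trans : ∀ {K L M} → groundL K → groundL L → groundL M → K ≼ L → L ≺ M → K ≺ M
    ≼-≺-trans gK gL gM (inj₁ K≺L) L≺M = ≺-trans _ _ _ gK gL gM K≺L L≺M
    ≼-≺-trans _  _  _  (inj₂ refl) L≺M = L≺M

    ≺-≼-trans : ∀ {K L M} → groundL K → groundL L → groundL M → K ≺ L → L ≼ M → K ≺ M
    ≺-≼-trans gK gL gM K≺L (inj₁ L≺M) = ≺-trans _ _ _ gK gL gM K≺L L≺M
    ≺-≼-trans _  _  _  K≺L (inj₂ refl) = K≺L

    ¬All≺⇒Any≽ : ∀ {L Ks} → groundL L → All groundL Ks → ¬ All (_≺ L) Ks →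
                 Any (λ M → groundL M × L ≼ M) Ks
    ¬All≺⇒Any≽ {Ks = []}    gL []         ¬all = ⊥-elim (¬all [])
    ¬All≺⇒Any≽ {L} {K ∷ Ks} gL (gK ∷ gKs) ¬all with ≺-total K L gK gL
    ... | inj₁ K≺L        = there (¬All≺⇒Any≽ gL gKs (λ all → ¬all (K≺L ∷ all)))
    ... | inj₂ (inj₁ K≡L) = here (gK , inj₂ (sym K≡L))
    ... | inj₂ (inj₂ L≺K) = here (gK , inj₁ L≺K)

    module _ (S : Clause → Set) (Sel : Clause → Literal → Set) (Mg : Literal → Set) where
      open Construction ord S Sel Mg

      FilterRel-All : ∀ {I} {P : Literal → Set} {C C'} → FilterRel I C C' → All P C → All P C'
      FilterRel-All f-nil          []       = []
      FilterRel-All (f-keep _ rel) (p ∷ ps) = p ∷ FilterRel-All rel ps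
      FilterRel-All (f-drop _ rel) (_ ∷ ps) = FilterRel-All rel ps

      F⇒ground : ∀ {C} → F C → groundC C
      F⇒ground (_ , _ , _ , groundCθ , _ , _ , rel , C↭) =
        All-resp-↭ (↭-sym C↭) (FilterRel-All rel groundCθ)

      largest-once⇒maximum : ∀ {L C} → Largest L C → OccursOnce L C → IsMaximum L C
      largest-once⇒maximum {L} (_ , all≼) (C' , C↭ , L∉C') =
        C' , C↭ , strict (All.tail (All-resp-↭ C↭ all≼)) L∉C'
        where
          strict : ∀ {Ks} → All (_≼ L) Ks → ¬ L ∈ Ks → All (_≺ L) Ks
          strict []                _   = []
          strict (inj₁ K≺L ∷ all≼) L∉ = K≺L ∷ strict all≼ (λ L∈ → L∉ (there L∈))
          strict (inj₂ refl ∷ _)   L∉ = ⊥-elim (L∉ (here refl))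

      dominated⇒<c : ∀ {C D} → C ≢ [] → All (λ K → Any (K ≺_) C) D → D <c C
      dominated⇒<c {C} {D} C≢[] dom =
        C , D , [] , ↭-sym (++-identityʳ C) , ↭-sym (++-identityʳ D) , C≢[] , dom

      common-dominated⇒<c : ∀ {L C C₁ D D₁} → C ↭ L ∷ C₁ → D ↭ L ∷ D₁ →
                            C₁ ≢ [] → All (λ K → Any (K ≺_) C₁) D₁ → D <c C
      common-dominated⇒<c {L} {C₁ = C₁} {D₁ = D₁} C↭ D↭ C₁≢[] dom =
        C₁ , D₁ , L ∷ [] , ↭-trans C↭ (∷↭∷ʳ L C₁) , ↭-trans D↭ (∷↭∷ʳ L D₁) , C₁≢[] , dom

      Int-pos : ∀ {T U A} → Int T U (pos A) ⇔ T A
      Int-pos = mk⇔ (λ { (inj₁ (_ , refl , t)) → t ; (inj₂ (_ , () , _)) })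
                    (λ t → inj₁ (_ , refl , t))

      -- The witness required for ¬ A in Int T U is neg A ∈ U itself.
      Int-neg : ∀ {T U A} → U (neg A) → Int T U (neg A) ⇔ (¬ T A)
      Int-neg u = mk⇔ (λ { (inj₁ (_ , () , _)) ; (inj₂ (_ , refl , ¬t , _)) → ¬t })
                      (λ ¬t → inj₂ (_ , refl , ¬t , neg _ , u , (λ { (_ , () , _) }) , inj₂ refl))

      module _ (Prod : Clause → Atom → Set) where
        open WithProd Prod

        ProducersBelow : Clause → Atom → Set
        ProducersBelow C B = ∀ {D} → F D → Prod D B → D <c C

        PF⇔P< : ∀ {C B} → ProducersBelow C B → PF B ⇔ (P< C) B
        PF⇔P< below = mk⇔ (λ (D , FD , p) → D , FD , below FD p , p)
                          (λ (D , FD , _ , p) → D , FD , p)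

        produced⇒MF : ∀ {C A} → F C → Prod C A → MF (pos A)
        produced⇒MF {C} FC p = Equivalence.from Int-pos (C , FC , p)

        module _ (isProduction : IsProduction) where

          producer-largest : ∀ {D B} → F D → Prod D B → Largest (pos B) D
          producer-largest FD p with _ , largest , _ ← Equivalence.to (isProduction _ _ FD) p =
            largest

          producer-maximum : ∀ {D B} → F D → Prod D B → IsMaximum (pos B) D
          producer-maximum FD p with _ , largest , _ , once ← Equivalence.to (isProduction _ _ FD) p =
            largest-once⇒maximum largest once

          producers-below-neg : ∀ {C B} → F C → neg B ∈ C → ProducersBelow C B
          producers-below-neg {C} {B} FC negB∈C FD p =
            dominated⇒<c (Any⇒≢[] negB∈C) (All.tabulate (λ K∈D →
              lose negB∈C (≼-≺-trans (All.lookup (F⇒ground FD) K∈D) gB gB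
                                     (All.lookup (proj₂ (producer-largest FD p)) K∈D) posB≺negB)))
            where
              gB : groundA B
              gB = All.lookup (F⇒ground FC) negB∈C
              posB≺negB : pos B ≺ neg B
              posB≺negB = ≺-ext (pos B) (neg B) gB gB (<ₗ-posneg B)

          producers-below-pos : ∀ {C B} → F C → pos B ∈ C → ¬ IsMaximum (pos B) C →
                                ProducersBelow C B
          producers-below-pos {C} {B} FC posB∈C ¬max FD p
            with C₁ , C↭ ← ∈⇒↭∷ posB∈C
               | D₁ , D↭ , D₁≺B ← producer-maximum FD p =
            common-dominated⇒<c C↭ D↭ (Any⇒≢[] someAbove) (All.tabulate (λ K∈D₁ →
              Any.map (λ (gM , B≼M) →
                        ≺-≼-trans (All.lookup gD₁ K∈D₁) gB gM (All.lookup D₁≺B K∈D₁) B≼M)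
                      someAbove))
            where
              gB : groundA B
              gB = All.lookup (F⇒ground FC) posB∈C
              gD₁ : All groundL D₁
              gD₁ = All.tail (All-resp-↭ D↭ (F⇒ground FD))
              someAbove : Any (λ M → groundL M × pos B ≼ M) C₁
              someAbove = ¬All≺⇒Any≽ gB (All.tail (All-resp-↭ C↭ (F⇒ground FC)))
                                     (λ all≺ → ¬max (C₁ , C↭ , all≺))

          MF⇔M<-nonmaximal : ∀ {C L} → F C → L ∈ C → ¬ IsMaximum L C → MF L ⇔ (M< C) L
          MF⇔M<-nonmaximal {C} {pos B} FC posB∈C ¬max = begin
            MF (pos B)     ≈⟨ Int-pos ⟩
            PF B           ≈⟨ PF⇔P< (producers-below-pos FC posB∈C ¬max) ⟩
            (P< C) B       ≈⟨ ⇔.sym Int-pos ⟩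
            (M< C) (pos B) ∎
          MF⇔M<-nonmaximal {C} {neg B} FC negB∈C _ = begin
            MF (neg B)     ≈⟨ Int-neg (C , FC , negB∈C) ⟩
            ¬ PF B         ≈⟨ ¬-cong-⇔ (PF⇔P< (producers-below-neg FC negB∈C)) ⟩
            ¬ (P< C) B     ≈⟨ ⇔.sym (Int-neg (inj₁ negB∈C)) ⟩
            (M< C) (neg B) ∎

mainTheorem4 : (sig : Signature) → let open Syntax sig in
    (ord : Ordering) (S : Clause → Set) (Sel : Clause → Literal → Set)
    (Mg : Literal → Set) → let open Construction ord S Sel Mg in
    IsSelection → IsInterpretation Mg → (∀ C → g C → Mg ⊨ C) →
    (Prod : Clause → Atom → Set) → let open WithProd Prod in
    IsProduction →
    ∀ (C : Clause) (L : Literal) → F C → L ∈ C →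
    (¬ IsMaximum L C → (MF L ⇔ (M< C) L))
    × (∀ A → L ≡ pos A → Prod C A → MF L)
mainTheorem4 sig ord S Sel Mg _ _ _ Prod isProduction C L FC L∈C =
  MF⇔M<-nonmaximal sig ord S Sel Mg Prod isProduction FC L∈C ,
  λ { A refl p → produced⇒MF sig ord S Sel Mg Prod FC p }
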